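{- Let $M\in\mathbb{R}^{n\times d}$ and let $\mathcal{F}(M)\subseteq\mathbb{B}^{n\times d}$ be the set of all types of points of $\mathbb{R}^n$ with respect to $M$. Then for every $T\in\mathcal{F}(M)$ and every $F\in\mathcal{P}_n$ we have $T\circ F\in\mathcal{F}(M)$; that is, the right action of the monoid $\mathcal{P}_n$ on $\mathbb{B}^{n\times d}$ restricts to an action on $\mathcal{F}(M)$.
   Context: $[n]=\{1,\dots,n\}$. $\mathbb{B}^{n\times d}$ is the set of $n\times d$ Boolean matrices; such a matrix is identified with the $d$-tuple $(S_1,\dots,S_d)$ of subsets of $[n]$ where $S_j=\{i: \text{entry }(i,j)=1\}$ is its $j$th column. $\mathcal{P}_n$ is the set of ordered set partitions $F=(F_1,\dots,F_l)$ of $[n]$ (blocks non-empty), a monoid (the face monoid of the braid arrangement) under the product $F*G=(F_1\cap G_1,\dots,F_1\cap G_r,F_2\cap G_1,\dots,F_l\cap G_r)^\sharp$, where $\sharp$ deletes empty sets, with identity $([n])$. For $I\subseteq[n]$ and $F\in\mathcal{P}_n$ set $I\circ F=\emptyset$ if $I=\emptyset$, and otherwise $I\circ F=I\cap F_j$ where $j$ is the largest index with $I\cap F_j\neq\emptyset$. This extends to Boolean matrices columnwise: $(S_1,\dots,S_d)\circ F=(S_1\circ F,\dots,S_d\circ F)$, giving a right action of $\mathcal{P}_n$ on $\mathbb{B}^{n\times d}$. For $a,y\in\mathbb{R}^n$ and $i\in[n]$, $\mathrm{Dom}_i(a)=\{y\in\mathbb{R}^n: y_i-a_i=\min_k(y_k-a_k)\}$.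 The type of $x\in\mathbb{R}^n$ with respect to $M$ (with columns $M_{\star j}$) is the $T\in\mathbb{B}^{n\times d}$ with $T_{ij}=1$ iff $x\in\mathrm{Dom}_i(M_{\star j})$. -}

module Defs where

open import Level using (Level; suc; _⊔_)
open import Data.Bool using (Bool; true; false; _∧_; _∨_; not)
open import Data.Nat using (ℕ)
open import Data.Fin using (Fin; _<_; _<?_)
open import Data.Product using (Σ; ∃; _×_)
open import Function.Bundles using (_⇔_)
open import Function.Definitions using (Surjective)
open import Relation.Binary.PropositionalEquality using (_≡_; _≢_)
open import Relation.Binary.Structures using (IsTotalOrder)
open import Relation.Nullary.Decidable using (⌊_⌋)

anyᶠ : ∀ {n} → (Fin n → Bool) → Bool
anyᶠ {ℕ.zero} p = false
anyᶠ {ℕ.suc n} p = p Fin.zero ∨ anyᶠ (λ i → p (Fin.suc i))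
open import Algebra.Structures using (IsCommutativeRing)

-- A (linearly) ordered field.  ℝ is an instance; the paper's statement
-- is the instance K = ℝ.
record OrderedField (c ℓ : Level) : Set (suc (c ⊔ ℓ)) where
  infixl 6 _+_
  infixl 7 _*_
  infix 4 _≤_
  field
    Carrier : Set c
    _+_ _*_ : Carrier → Carrier → Carrier
    -_      : Carrier → Carrier
    0# 1#   : Carrier
    _≤_     : Carrier → Carrier → Set ℓ
    isCommutativeRing : IsCommutativeRing _≡_ _+_ _*_ -_ 0# 1#
    isTotalOrder      : IsTotalOrder _≡_ _≤_
    0≢1      : 0# ≢ 1#
    inverse  : ∀ x → x ≢ 0# → Σ Carrier (λ y → x * y ≡ 1#)
    +-mono-≤ : ∀ {x y} z → x ≤ y → x + z ≤ y + z
    *-nonneg : ∀ {x y} → 0# ≤ x → 0# ≤ y → 0# ≤ x * y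

  _-_ : Carrier → Carrier → Carrier
  x - y = x + (- y)

-- Boolean n×d matrices: entry (i,j); column j is the subset {i | T i j ≡ true}.
BMat : ℕ → ℕ → Set
BMat n d = Fin n → Fin d → Bool

-- An ordered set partition (F_1,…,F_l) of [n] with non-empty blocks is
-- encoded by its block-index map  blk : Fin n → Fin l  (i ∈ F_{blk i}),
-- required to be surjective (every block non-empty).
record OSP (n : ℕ) : Set where
  field
    l    : ℕ
    blk  : Fin n → Fin l
    surj : Surjective _≡_ _≡_ blk

-- I ∘ F for a subset I ⊆ [n] (as a characteristic function):
-- empty if I is empty, otherwise I ∩ F_j with j the largest block index
-- meeting I.
_∘ₛ_ : ∀ {n} → (Fin n → Bool) → OSP n → (Fin n → Bool)
(I ∘ₛ F) i = I i ∧ not (anyᶠ (λ i' → I i' ∧ ⌊ blk i <? blk i' ⌋))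
  where open OSP F

_∘ₘ_ : ∀ {n d} → BMat n d → OSP n → BMat n d
(T ∘ₘ F) i j = ((λ k → T k j) ∘ₛ F) i

module _ {c ℓ} (K : OrderedField c ℓ) where
  open OrderedField K

  Dom : ∀ {n} → (a : Fin n → Carrier) → Fin n → (Fin n → Carrier) → Set ℓ
  Dom a i y = ∀ k → (y i - a i) ≤ (y k - a k)

  IsTypeOf : ∀ {n d} → (Fin n → Fin d → Carrier) → (Fin n → Carrier) → BMat n d → Set ℓ
  IsTypeOf M x T = ∀ i j → (T i j ≡ true) ⇔ Dom (λ k → M k j) i x

  InTypes : ∀ {n d} → (Fin n → Fin d → Carrier) → BMat n d → Set (c ⊔ ℓ)
  InTypes {n} M T = Σ (Fin n → Carrier) (λ x → IsTypeOf M x T)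

-- Perturb a point x of type T to y = x + q, where q is positive, smaller
-- than every gap between a minimal and a non-minimal value of a column of
-- x - M, and strictly decreasing in the block index: q k = U / 2^(blk k).
-- The perturbation cannot make a non-minimal entry minimal, and among the
-- minimal entries of a column it favours exactly those in the last block
-- they meet, which is the column of T ∘ F.

module Submission where

open import Defs
open import Algebra.Bundles using (CommutativeRing)
import Algebra.Properties.AbelianGroup as AbelianGroupProperties
import Algebra.Properties.CommutativeSemigroup as CommutativeSemigroupProperties
import Algebra.Properties.Group as GroupProperties
import Algebra.Properties.Ring as RingProperties
open import Data.Bool using (Bool; true; false; _∧_; not)
open import Data.Bool.Properties using (∧-conicalˡ; ∧-conicalʳ)
open import Data.Empty using (⊥-elim)
open import Data.Fin as Fin using (Fin; zero; suc; toℕ; _<?_)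
open import Data.Nat as ℕ using (ℕ)
open import Data.Nat.Properties using (≮⇒≥; ≤⇒≤′)
open import Data.Product using (∃; _×_; _,_; proj₁; proj₂)
open import Data.Sum using (inj₁; inj₂)
open import Function using (_∘_; case_of_)
open import Function.Bundles using (_⇔_; mk⇔; Equivalence)
open import Function.Construct.Composition using () renaming (equivalence to ⇔-trans)
open import Function.Construct.Symmetry using (⇔-sym)
open import Relation.Binary.Bundles using (Poset)
open import Relation.Binary.PropositionalEquality
  using (_≡_; _≢_; refl; sym; trans; cong; cong₂; subst; subst₂)
open import Relation.Binary.Structures using (IsTotalOrder)
import Relation.Binary.Construct.NonStrictToStrict as NonStrictToStrict
import Relation.Binary.Reasoning.PartialOrder as PartialOrderReasoning
open import Relation.Nullary using (¬_; Dec; yes; no)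
open import Relation.Nullary.Decidable using (⌊_⌋)

open Equivalence using (to; from)

⌊⌋≡true⇔ : ∀ {a} {A : Set a} (a? : Dec A) → ⌊ a? ⌋ ≡ true ⇔ A
⌊⌋≡true⇔ (yes a) = mk⇔ (λ _ → a) (λ _ → refl)
⌊⌋≡true⇔ (no ¬a) = mk⇔ (λ ()) (λ a → ⊥-elim (¬a a))

anyᶠ≡true⇔ : ∀ {n} (p : Fin n → Bool) → anyᶠ p ≡ true ⇔ ∃ λ k → p k ≡ true
anyᶠ≡true⇔ {ℕ.zero} p = mk⇔ (λ ()) (λ ())
anyᶠ≡true⇔ {ℕ.suc n} p with p zero in p₀
... | true = mk⇔ (λ _ → zero , p₀) (λ _ → refl)
... | false = mk⇔ later (λ { (zero , p₀′) → case trans (sym p₀) p₀′ of λ ()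
                           ; (suc k , pk) → from (anyᶠ≡true⇔ (p ∘ suc)) (k , pk) })
  where
  later : anyᶠ (p ∘ suc) ≡ true → ∃ λ k → p k ≡ true
  later h with k , pk ← to (anyᶠ≡true⇔ (p ∘ suc)) h = suc k , pk

∘ₛ≡true⇔ : ∀ {n} (I : Fin n → Bool) (F : OSP n) i →
           (I ∘ₛ F) i ≡ true ⇔
           (I i ≡ true × ∀ k → I k ≡ true → ¬ OSP.blk F i Fin.< OSP.blk F k)
∘ₛ≡true⇔ {n} I F i = mk⇔ ⇒ ⇐
  where
  open OSP F

  later : Fin n → Bool
  later k = I k ∧ ⌊ blk i <? blk k ⌋

  later≡true : ∀ {k} → I k ≡ true → blk i Fin.< blk k → anyᶠ later ≡ true
  later≡true {k} Ik i<k =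
    from (anyᶠ≡true⇔ later) (k , cong₂ _∧_ Ik (from (⌊⌋≡true⇔ (blk i <? blk k)) i<k))

  ⇒ : (I ∘ₛ F) i ≡ true → I i ≡ true × ∀ k → I k ≡ true → ¬ blk i Fin.< blk k
  ⇒ h = ∧-conicalˡ _ _ h , λ k Ik i<k →
    case subst (λ b → not b ≡ true) (later≡true Ik i<k) (∧-conicalʳ _ _ h) of λ ()

  none-later : (∀ k → I k ≡ true → ¬ blk i Fin.< blk k) → not (anyᶠ later) ≡ true
  none-later none with anyᶠ later in any
  ... | false = refl
  ... | true =
    let k , lk = to (anyᶠ≡true⇔ later) any
    in ⊥-elim (none k (∧-conicalˡ _ _ lk)
                      (to (⌊⌋≡true⇔ (blk i <? blk k)) (∧-conicalʳ _ _ lk)))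

  ⇐ : (I i ≡ true × ∀ k → I k ≡ true → ¬ blk i Fin.< blk k) → (I ∘ₛ F) i ≡ true
  ⇐ (Ii , none) = cong₂ _∧_ Ii (none-later none)

module OrderedFieldProperties {c ℓ} (K : OrderedField c ℓ) where
  open OrderedField K
  open IsTotalOrder isTotalOrder using (total; antisym; isPartialOrder)
    renaming (refl to ≤-refl; trans to ≤-trans)

  commutativeRing : CommutativeRing c c
  commutativeRing = record { isCommutativeRing = isCommutativeRing }

  open CommutativeRing commutativeRing
    using (+-comm; +-identityˡ; +-identityʳ; -‿inverseʳ; *-identityˡ; *-identityʳ;
           distribˡ; distribʳ; +-abelianGroup; +-commutativeSemigroup; ring)
  open AbelianGroupProperties +-abelianGroup using (xyx⁻¹≈y)
  open GroupProperties (CommutativeRing.+-group commutativeRing) using (x∙y⁻¹≈ε⇒x≈y; ∙-cancelˡ)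
  open CommutativeSemigroupProperties +-commutativeSemigroup using (x∙yz≈y∙xz)
  open RingProperties ring using (-1*x≈-x; -‿involutive)

  poset : Poset c c ℓ
  poset = record { isPartialOrder = isPartialOrder }

  open NonStrictToStrict _≡_ _≤_ public using (_<_; <⇒≤; <⇒≉)
  open NonStrictToStrict _≡_ _≤_ using (<⇒≱; <-trans)
  open PartialOrderReasoning poset public

  +-monoʳ-≤ : ∀ a {p q} → p ≤ q → a + p ≤ a + q
  +-monoʳ-≤ a {p} {q} p≤q = subst₂ _≤_ (+-comm p a) (+-comm q a) (+-mono-≤ a p≤q)

  +-cancelˡ-≤ : ∀ a {p q} → a + p ≤ a + q → p ≤ q
  +-cancelˡ-≤ a {p} {q} le = subst₂ _≤_ (xyx⁻¹≈y a p) (xyx⁻¹≈y a q) (+-mono-≤ (- a) le)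

  x≤x+y : ∀ a {q} → 0# ≤ q → a ≤ a + q
  x≤x+y a {q} 0≤q = subst (_≤ a + q) (+-identityʳ a) (+-monoʳ-≤ a 0≤q)

  x<x+y : ∀ a {q} → 0# < q → a < a + q
  x<x+y a {q} (0≤q , 0≢q) =
    x≤x+y a 0≤q , λ a≡a+q → 0≢q (∙-cancelˡ a 0# q (trans (+-identityʳ a) a≡a+q))

  x<y⇒0<y-x : ∀ {x y} → x < y → 0# < y - x
  x<y⇒0<y-x {x} {y} (x≤y , x≢y) =
    subst (_≤ y - x) (-‿inverseʳ x) (+-mono-≤ (- x) x≤y) ,
    λ 0≡y-x → x≢y (sym (x∙y⁻¹≈ε⇒x≈y y x (sym 0≡y-x)))

  x+[y-x]≡y : ∀ x y → x + (y - x) ≡ y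
  x+[y-x]≡y x y = begin-equality
    x + (y - x)   ≡⟨ x∙yz≈y∙xz x y (- x) ⟩
    y + (x - x)   ≡⟨ cong (y +_) (-‿inverseʳ x) ⟩
    y + 0#        ≡⟨ +-identityʳ y ⟩
    y             ∎

  -- In an ordered ring 0 ≤ (-1)², which rules out 1 ≤ 0.
  0<1 : 0# < 1#
  0<1 with total 0# 1#
  ... | inj₁ 0≤1 = 0≤1 , 0≢1
  ... | inj₂ 1≤0 = ⊥-elim (0≢1 (antisym 0≤1 1≤0))
    where
    0≤-1 : 0# ≤ - 1#
    0≤-1 = subst₂ _≤_ (-‿inverseʳ 1#) (+-identityˡ (- 1#)) (+-mono-≤ (- 1#) 1≤0)
    0≤1 : 0# ≤ 1#
    0≤1 = subst (0# ≤_) (trans (-1*x≈-x (- 1#)) (-‿involutive 1#)) (*-nonneg 0≤-1 0≤-1)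

  0<x+x⇒0<x : ∀ {x} → 0# < x + x → 0# < x
  0<x+x⇒0<x {x} 0<x+x with total 0# x
  ... | inj₁ 0≤x = 0≤x , λ 0≡x →
    <⇒≉ 0<x+x (sym (trans (cong₂ _+_ (sym 0≡x) (sym 0≡x)) (+-identityʳ 0#)))
  ... | inj₂ x≤0 = ⊥-elim (<⇒≱ antisym 0<x+x (begin
    x + x    ≤⟨ +-mono-≤ x x≤0 ⟩
    0# + x   ≤⟨ +-monoʳ-≤ 0# x≤0 ⟩
    0# + 0#  ≡⟨ +-identityʳ 0# ⟩
    0#       ∎))

  0<2 : 0# < 1# + 1#
  0<2 = <-trans isPartialOrder 0<1 (x<x+y 1# 0<1)

  half : Carrier
  half = proj₁ (inverse (1# + 1#) (λ 2≡0 → <⇒≉ 0<2 (sym 2≡0)))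

  halve : Carrier → Carrier
  halve u = u * half

  halve+halve : ∀ u → halve u + halve u ≡ u
  halve+halve u = begin-equality
    u * half + u * half  ≡⟨ distribˡ u half half ⟨
    u * (half + half)    ≡⟨ cong (u *_) half+half ⟩
    u * 1#               ≡⟨ *-identityʳ u ⟩
    u                    ∎
    where
    half+half : half + half ≡ 1#
    half+half = begin-equality
      half + half            ≡⟨ cong₂ _+_ (*-identityˡ half) (*-identityˡ half) ⟨
      1# * half + 1# * half  ≡⟨ distribʳ half 1# 1# ⟨
      (1# + 1#) * half       ≡⟨ proj₂ (inverse (1# + 1#) _) ⟩
      1#                     ∎

  halve-pos : ∀ {u} → 0# < u → 0# < halve u
  halve-pos {u} 0<u = 0<x+x⇒0<x (subst (0# <_) (sym (halve+halve u)) 0<u)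

  halve-< : ∀ {u} → 0# < u → halve u < u
  halve-< {u} 0<u = subst (halve u <_) (halve+halve u) (x<x+y (halve u) (halve-pos 0<u))

  halvings : Carrier → ℕ → Carrier
  halvings u ℕ.zero = u
  halvings u (ℕ.suc m) = halve (halvings u m)

  module _ {u} (0<u : 0# < u) where

    halvings-pos : ∀ m → 0# < halvings u m
    halvings-pos ℕ.zero = 0<u
    halvings-pos (ℕ.suc m) = halve-pos (halvings-pos m)

    halvings-antitone : ∀ {m m′} → m ℕ.≤ m′ → halvings u m′ ≤ halvings u m
    halvings-antitone = antitone′ ∘ ≤⇒≤′
      where
      antitone′ : ∀ {m m′} → m ℕ.≤′ m′ → halvings u m′ ≤ halvings u m
      antitone′ ℕ.≤′-refl = ≤-refl
      antitone′ (ℕ.≤′-step {n} m≤′n) =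
        ≤-trans (<⇒≤ (halve-< (halvings-pos n))) (antitone′ m≤′n)

    halvings-strictlyAntitone : ∀ {m m′} → m ℕ.< m′ → halvings u m′ < halvings u m
    halvings-strictlyAntitone {m} {m′} m<m′ = begin-strict
      halvings u m′           ≤⟨ halvings-antitone m<m′ ⟩
      halvings u (ℕ.suc m)    <⟨ halve-< (halvings-pos m) ⟩
      halvings u m            ∎

    halvings-≤⇔≮ : ∀ {m m′} → halvings u m ≤ halvings u m′ ⇔ (¬ m ℕ.< m′)
    halvings-≤⇔≮ = mk⇔ (λ le m<m′ → <⇒≱ antisym (halvings-strictlyAntitone m<m′) le)
                       (halvings-antitone ∘ ≮⇒≥)

  positiveLowerBound : ∀ {m} (f : Fin m → Carrier) → (∀ a → 0# < f a) →
                       ∃ λ u → 0# < u × ∀ a → u ≤ f a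
  positiveLowerBound {ℕ.zero} f f-pos = 1# , 0<1 , λ ()
  positiveLowerBound {ℕ.suc m} f f-pos
    with u , 0<u , u≤f ← positiveLowerBound (f ∘ suc) (f-pos ∘ suc)
       | total (f zero) u
  ... | inj₁ f₀≤u =
    f zero , f-pos zero , λ { zero → ≤-refl ; (suc a) → ≤-trans f₀≤u (u≤f a) }
  ... | inj₂ u≤f₀ = u , 0<u , λ { zero → u≤f₀ ; (suc a) → u≤f a }

module Argmin {c ℓ} (K : OrderedField c ℓ) where
  open OrderedField K
  open OrderedFieldProperties K
  open IsTotalOrder isTotalOrder using (total; antisym) renaming (refl to ≤-refl; trans to ≤-trans)

  IsArgmin : ∀ {n} → (Fin n → Carrier) → Fin n → Set ℓ
  IsArgmin v i = ∀ k → v i ≤ v k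

  argmin : ∀ {n} → Fin n → (v : Fin n → Carrier) → ∃ (IsArgmin v)
  argmin {ℕ.suc ℕ.zero} _ v = zero , λ { zero → ≤-refl }
  argmin {ℕ.suc (ℕ.suc n)} _ v
    with i , i-min ← argmin zero (v ∘ suc) | total (v zero) (v (suc i))
  ... | inj₁ v₀≤vᵢ = zero , λ { zero → ≤-refl ; (suc k) → ≤-trans v₀≤vᵢ (i-min k) }
  ... | inj₂ vᵢ≤v₀ = suc i , λ { zero → vᵢ≤v₀ ; (suc k) → i-min k }

  argmin-unique-value : ∀ {n} {v : Fin n → Carrier} {i k} →
                        IsArgmin v i → IsArgmin v k → v i ≡ v k
  argmin-unique-value i-min k-min = antisym (i-min _) (k-min _)

  IsArgmin-cong : ∀ {n} {v w : Fin n → Carrier} → (∀ k → v k ≡ w k) →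
                  ∀ i → IsArgmin v i ⇔ IsArgmin w i
  IsArgmin-cong v≗w i = mk⇔ (λ i-min k → subst₂ _≤_ (v≗w i) (v≗w k) (i-min k))
                            (λ i-min k → subst₂ _≤_ (sym (v≗w i)) (sym (v≗w k)) (i-min k))

  -- S decides the argmin set of v; this is what the Boolean columns of a type provide,
  -- since ≤ itself need not be decidable.
  module _ {n} (v : Fin n → Carrier) (S : Fin n → Bool)
           (S⇔argmin : ∀ i → S i ≡ true ⇔ IsArgmin v i) where

    private
      S⇒argmin : ∀ {i} → S i ≡ true → IsArgmin v i
      S⇒argmin {i} = to (S⇔argmin i)

      argmin⇒S : ∀ {i} → IsArgmin v i → S i ≡ true
      argmin⇒S {i} = from (S⇔argmin i)

    argmin-gap : ∃ λ U → 0# < U × ∀ i k → S i ≡ true → S k ≡ false → v i + U ≤ v k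
    argmin-gap = gapBelow (positiveLowerBound (proj₁ ∘ rowBound) (proj₁ ∘ proj₂ ∘ rowBound))
      where
      separation : Bool → Bool → Carrier → Carrier → Carrier
      separation true false a b = b - a
      separation _    _     _ _ = 1#

      separation-pos : ∀ i k → 0# < separation (S i) (S k) (v i) (v k)
      separation-pos i k with S i in Si | S k in Sk
      ... | true  | true  = 0<1
      ... | false | _     = 0<1
      ... | true  | false = x<y⇒0<y-x (S⇒argmin Si k , vi≢vk)
        where
        vi≢vk : v i ≢ v k
        vi≢vk vi≡vk = case trans (sym Sk) (argmin⇒S k-min) of λ ()
          where
          k-min : IsArgmin v k
          k-min k′ = subst (_≤ v k′) vi≡vk (S⇒argmin Si k′)

      rowBound : ∀ i → ∃ λ u → 0# < u × ∀ k → u ≤ separation (S i) (S k) (v i) (v k)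
      rowBound i = positiveLowerBound _ (separation-pos i)

      gapBelow : (∃ λ U → 0# < U × ∀ i → U ≤ proj₁ (rowBound i)) →
                 ∃ λ U → 0# < U × ∀ i k → S i ≡ true → S k ≡ false → v i + U ≤ v k
      gapBelow (U , 0<U , U≤rowBound) = U , 0<U , λ i k Si Sk → begin
        v i + U            ≤⟨ +-monoʳ-≤ (v i) (begin
          U                                     ≤⟨ U≤rowBound i ⟩
          proj₁ (rowBound i)                    ≤⟨ proj₂ (proj₂ (rowBound i)) k ⟩
          separation (S i) (S k) (v i) (v k)    ≡⟨ cong₂ (λ a b → separation a b (v i) (v k)) Si Sk ⟩
          v k - v i                             ∎) ⟩
        v i + (v k - v i)  ≡⟨ x+[y-x]≡y (v i) (v k) ⟩
        v k                ∎

    module _ {U} (0<U : 0# < U) (gap : ∀ i k → S i ≡ true → S k ≡ false → v i + U ≤ v k)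
             (rank : Fin n → ℕ) where

      private
        q : Fin n → Carrier
        q k = halvings U (rank k)

        q-pos : ∀ k → 0# < q k
        q-pos k = halvings-pos 0<U (rank k)

        q≤U : ∀ k → q k ≤ U
        q≤U k = halvings-antitone 0<U {m′ = rank k} ℕ.z≤n

      argmin-perturbed⇔ : ∀ i → IsArgmin (λ k → v k + q k) i ⇔
                                (S i ≡ true × ∀ k → S k ≡ true → ¬ rank i ℕ.< rank k)
      argmin-perturbed⇔ i = mk⇔ ⇒ ⇐
        where
        ⇒ : IsArgmin (λ k → v k + q k) i → S i ≡ true × ∀ k → S k ≡ true → ¬ rank i ℕ.< rank k
        ⇒ i-min with S i in Si
        ... | true = refl , λ k Sk → to (halvings-≤⇔≮ 0<U) (+-cancelˡ-≤ (v i)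
                       (subst (λ t → v i + q i ≤ t + q k)
                              (sym (argmin-unique-value (S⇒argmin Si) (S⇒argmin Sk)))
                              (i-min k)))
        ... | false with i₀ , i₀-min ← argmin i v = begin-contradiction
              v i          <⟨ x<x+y (v i) (q-pos i) ⟩
              v i + q i    ≤⟨ i-min i₀ ⟩
              v i₀ + q i₀  ≤⟨ +-monoʳ-≤ (v i₀) (q≤U i₀) ⟩
              v i₀ + U     ≤⟨ gap i₀ i (argmin⇒S i₀-min) Si ⟩
              v i          ∎

        ⇐ : S i ≡ true × (∀ k → S k ≡ true → ¬ rank i ℕ.< rank k) →
            IsArgmin (λ k → v k + q k) i
        ⇐ (Si , maximalRank) k with S k in Sk
        ... | true = begin
              v i + q i  ≤⟨ +-monoʳ-≤ (v i) (from (halvings-≤⇔≮ 0<U) (maximalRank k Sk)) ⟩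
              v i + q k  ≡⟨ cong (_+ q k) (argmin-unique-value (S⇒argmin Si) (S⇒argmin Sk)) ⟩
              v k + q k  ∎
        ... | false = begin
              v i + q i  ≤⟨ +-monoʳ-≤ (v i) (q≤U i) ⟩
              v i + U    ≤⟨ gap i k Si Sk ⟩
              v k        ≤⟨ x≤x+y (v k) (<⇒≤ (q-pos k)) ⟩
              v k + q k  ∎

  argmin-commonGap : ∀ {d n} (v : Fin d → Fin n → Carrier) (S : Fin d → Fin n → Bool) →
                     (∀ j i → S j i ≡ true ⇔ IsArgmin (v j) i) →
                     ∃ λ U → 0# < U × ∀ j i k → S j i ≡ true → S j k ≡ false → v j i + U ≤ v j k
  argmin-commonGap v S S⇔argmin =
    gapBelow (positiveLowerBound (proj₁ ∘ columnGap) (proj₁ ∘ proj₂ ∘ columnGap))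
    where
    columnGap : ∀ j → ∃ λ U → 0# < U × ∀ i k → S j i ≡ true → S j k ≡ false → v j i + U ≤ v j k
    columnGap j = argmin-gap (v j) (S j) (S⇔argmin j)

    gapBelow : (∃ λ U → 0# < U × ∀ j → U ≤ proj₁ (columnGap j)) →
               ∃ λ U → 0# < U × ∀ j i k → S j i ≡ true → S j k ≡ false → v j i + U ≤ v j k
    gapBelow (U , 0<U , U≤columnGap) = U , 0<U , λ j i k Si Sk →
      ≤-trans (+-monoʳ-≤ (v j i) (U≤columnGap j)) (proj₂ (proj₂ (columnGap j)) i k Si Sk)

corollary6p5 : ∀ {c ℓ} (K : OrderedField c ℓ) (n d : ℕ)
                 (M : Fin n → Fin d → OrderedField.Carrier K) (T : BMat n d) (F : OSP n) →
                 InTypes K M T → InTypes K M (T ∘ₘ F)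
corollary6p5 K n d M T F (x , x-type) = y , y-type
  where
  open OrderedField K
  open OrderedFieldProperties K
  open Argmin K
  open OSP F
  open CommutativeSemigroupProperties (CommutativeRing.+-commutativeSemigroup commutativeRing)
    using (xy∙z≈xz∙y)

  v : Fin d → Fin n → Carrier
  v j k = x k - M k j

  gap : ∃ λ U → 0# < U × ∀ j i k → T i j ≡ true → T k j ≡ false → v j i + U ≤ v j k
  gap = argmin-commonGap v (λ j i → T i j) (λ j i → x-type i j)

  q : Fin n → Carrier
  q k = halvings (proj₁ gap) (toℕ (blk k))

  y : Fin n → Carrier
  y k = x k + q k

  y-type : IsTypeOf K M y (T ∘ₘ F)
  y-type i j = ⇔-trans (∘ₛ≡true⇔ (λ k → T k j) F i) (⇔-sym (⇔-trans
    (IsArgmin-cong (λ k → xy∙z≈xz∙y (x k) (q k) (- M k j)) i)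
    (argmin-perturbed⇔ (v j) (λ k → T k j) (λ i → x-type i j)
                       (proj₁ (proj₂ gap)) (proj₂ (proj₂ gap) j) (toℕ ∘ blk) i)))
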